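{- Let $g\ge 1$ and let $k$ be a nonnegative integer with $k\ge 2^{g-1}-1$. Let $A_g$ be a hub vertex of the pseudofractal scale-free web $\mathcal{G}_g$. Then $P^{\infty}_{\mathcal{G}_g,k}(\{A_g\})=V(\mathcal{G}_g)$; in particular the $k$-power domination number of $\mathcal{G}_g$ is $1$.
   Context: Pseudofractal scale-free web: $\mathcal{G}_1$ is a triangle (three vertices, three edges). For $g\ge 1$, $\mathcal{G}_{g+1}$ is obtained from $\mathcal{G}_g$ by adding, for every edge $uv$ of $\mathcal{G}_g$, a new vertex adjacent to exactly $u$ and $v$. The three vertices of $\mathcal{G}_1$ (present in every $\mathcal{G}_g$) are called the hub vertices, denoted $A_g,B_g,C_g$. For a graph $G$, $N_G[v]$ is the closed neighborhood of $v$ and $N_G[D]=\bigcup_{v\in D}N_G[v]$. For a nonnegative integer $k$ and $D\subseteq V(G)$, define $P^0_{G,k}(D)=N_G[D]$ and $P^{i+1}_{G,k}(D)=\bigcup\{N_G[v]: v\in P^i_{G,k}(D),\ |N_G[v]\setminus P^i_{G,k}(D)|\le k\}$; these sets increase with $i$ and stabilize (for finite $G$) at a set denoted $P^\infty_{G,k}(D)$. $D$ is a $k$-power dominating set if $P^\infty_{G,k}(D)=V(G)$, and the $k$-power domination number $\gamma_{P,k}(G)$ is the minimum cardinality of a $k$-power dominating set. -}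

module Defs where

open import Data.Nat using (ℕ; zero; suc; _+_; _≡ᵇ_; _≤ᵇ_; _≤_; _<_)
open import Data.Bool using (Bool; true; false; _∧_; _∨_; not)
open import Data.List using (List; []; _∷_; _++_; length; filter; upTo)
open import Data.Bool.ListAction using (any)
open import Data.Product using (_×_; _,_; proj₁; proj₂; ∃)
open import Relation.Binary.PropositionalEquality using (_≡_)
open import Relation.Nullary.Decidable using (yes; no)
open import Data.Bool using (T?)

-- A finite simple graph: vertices are 0 , … , n-1, edges an (unordered) list of pairs.
record Graph : Set where
  constructor mkGraph
  field
    n : ℕ
    E : List (ℕ × ℕ)
open Graph public

adj : Graph → ℕ → ℕ → Bool
adj G u v = any (λ e → ((proj₁ e ≡ᵇ u) ∧ (proj₂ e ≡ᵇ v)) ∨ ((proj₁ e ≡ᵇ v) ∧ (proj₂ e ≡ᵇ u))) (E G)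

inN : Graph → ℕ → ℕ → Bool
inN G v w = (v ≡ᵇ w) ∨ adj G v w

verts : Graph → List ℕ
verts G = upTo (n G)

-- Vertex subsets as Boolean predicates (only values on vertices 0..n-1 matter).
VSet : Set
VSet = ℕ → Bool

closedNbhd : Graph → VSet → VSet
closedNbhd G D w = any (λ v → D v ∧ inN G v w) (verts G)

outside : Graph → VSet → ℕ → ℕ
outside G S v = length (filter (λ w → T? (inN G v w ∧ not (S w))) (verts G))

P : Graph → ℕ → VSet → ℕ → VSet
P G k D zero = closedNbhd G D
P G k D (suc i) w =
  any (λ v → P G k D i v ∧ (outside G (P G k D i) v ≤ᵇ k) ∧ inN G v w) (verts G)

-- P^∞_{G,k}(D): the union of the increasing chain P^0 ⊆ P^1 ⊆ … (= its stable value)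
P∞ : Graph → ℕ → VSet → ℕ → Set
P∞ G k D w = ∃ λ i → P G k D i w ≡ true

IsKPDS : Graph → ℕ → VSet → Set
IsKPDS G k D = ∀ w → w < n G → P∞ G k D w

card : Graph → VSet → ℕ
card G D = length (filter (λ v → T? (D v)) (verts G))

γPk≡ : Graph → ℕ → ℕ → Set
γPk≡ G k m = (∃ λ D → (card G D ≡ m) × IsKPDS G k D)
           × (∀ D → IsKPDS G k D → m ≤ card G D)

singleton : ℕ → VSet
singleton a v = a ≡ᵇ v

newEdges : ℕ → List (ℕ × ℕ) → List (ℕ × ℕ)
newEdges m [] = []
newEdges m ((u , v) ∷ es) = (u , m) ∷ (v , m) ∷ newEdges (suc m) es

step : Graph → Graph
step G = mkGraph (n G + length (E G)) (E G ++ newEdges (n G) (E G))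

triangle : Graph
triangle = mkGraph 3 ((0 , 1) ∷ (1 , 2) ∷ (0 , 2) ∷ [])

-- 𝒢 g for g ≥ 1 (𝒢 0 is an unused dummy, set to the triangle).
-- Hub vertices A_g, B_g, C_g are 0, 1, 2.
𝒢 : ℕ → Graph
𝒢 zero = triangle
𝒢 (suc zero) = triangle
𝒢 (suc (suc m)) = step (𝒢 (suc m))

-- Read 𝒢 (m + 1) as three copies of 𝒢 m glued pairwise at their hubs: the copy avoiding hub r is
-- region r, and every inner (non-hub) vertex is labelled by its region. Along the subdivision steps
-- one maintains that in 𝒢 (m + 1) an inner vertex has degree at most 2^m and is adjacent either to
-- both hubs of its region or to an older inner vertex of its region, and that a hub has at most 2^m
-- neighbours in each region containing it.
-- From hub a all hubs are observed at once. An observed inner vertex has an observed neighbour,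
-- hence at most 2^m - 1 ≤ k unobserved ones, so it propagates; by induction on age this observes
-- the two regions containing a. Then a second hub b has all its unobserved neighbours in region a,
-- which also contains the observed third hub, so b propagates and region a follows in the same way.

module Submission where

open import Defs
open import Data.Nat using (ℕ; zero; suc; _+_; _⊔_; _*_; _≤_; _<_; _^_; _∸_; _≡ᵇ_; _≤ᵇ_; _<ᵇ_; z≤n; s≤s; z<s)
open import Data.Nat.Properties
open import Data.Bool using (Bool; true; false; _∧_; _∨_; not; if_then_else_; T; T?)
open import Data.Bool.Properties using (T-≡; ¬-not; not-¬; ∨-comm; ∧-zeroʳ; ∧-identityʳ)
open import Data.Bool.ListAction using (any)
open import Data.List using (List; []; _∷_; _++_; length; filter)
open import Data.List.Membership.Propositional using (_∈_)
open import Data.List.Membership.Propositional.Properties using (∈-upTo⁺; ∈-upTo⁻; ∈-++⁺ˡ; ∈-++⁺ʳ; ∈-++⁻)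
open import Data.List.Relation.Unary.Any using (here; there)
open import Data.List.Relation.Unary.All using () renaming (lookup to All-lookup)
open import Data.List.Relation.Unary.AllPairs using (_∷_)
open import Data.List.Relation.Unary.Unique.Propositional using (Unique)
open import Data.List.Relation.Unary.Unique.Propositional.Properties using (upTo⁺)
open import Data.Product using (_×_; _,_; proj₁; proj₂; ∃)
open import Data.Sum using (_⊎_; inj₁; inj₂)
open import Data.Unit using (⊤; tt)
open import Data.Empty using (⊥-elim)
open import Function using (_∘_; const)
open import Function.Bundles using (Equivalence)
open import Relation.Binary.PropositionalEquality
open import Relation.Nullary using (¬_; yes; no)
open import Relation.Nullary.Decidable using (_×-dec_; ¬?)
open import Relation.Unary using (Decidable)
open import Data.Nat.Induction using (<-rec)
open import Algebra.Properties.CommutativeSemigroup +-commutativeSemigroup using (interchange)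

bit : Bool → ℕ
bit true = 1
bit false = 0

bit≤1 : ∀ b → bit b ≤ 1
bit≤1 true = ≤-refl
bit≤1 false = z≤n

T⇒≡true : ∀ {b} → T b → b ≡ true
T⇒≡true = Equivalence.to T-≡

≡true⇒T : ∀ {b} → b ≡ true → T b
≡true⇒T = Equivalence.from T-≡

¬T⇒≡false : ∀ {b} → ¬ T b → b ≡ false
¬T⇒≡false ¬b = ¬-not (¬b ∘ ≡true⇒T)

∧-true⁻ : ∀ a b → a ∧ b ≡ true → a ≡ true × b ≡ true
∧-true⁻ true true refl = refl , refl

∨-true⁻ : ∀ a b → a ∨ b ≡ true → a ≡ true ⊎ b ≡ true
∨-true⁻ true b _ = inj₁ refl
∨-true⁻ false b e = inj₂ e

∨-trueʳ : ∀ a {b} → b ≡ true → a ∨ b ≡ true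
∨-trueʳ true _ = refl
∨-trueʳ false e = e

≡ᵇ-true⇒≡ : ∀ {m n} → (m ≡ᵇ n) ≡ true → m ≡ n
≡ᵇ-true⇒≡ {m} {n} e = ≡ᵇ⇒≡ m n (≡true⇒T e)

≡⇒≡ᵇ-true : ∀ {m n} → m ≡ n → (m ≡ᵇ n) ≡ true
≡⇒≡ᵇ-true {m} {n} e = T⇒≡true (≡⇒≡ᵇ m n e)

≢⇒≡ᵇ-false : ∀ {m n} → m ≢ n → (m ≡ᵇ n) ≡ false
≢⇒≡ᵇ-false {m} {n} m≢n = ¬T⇒≡false (m≢n ∘ ≡ᵇ⇒≡ m n)

≤⇒≤ᵇ-true : ∀ {m n} → m ≤ n → (m ≤ᵇ n) ≡ true
≤⇒≤ᵇ-true = T⇒≡true ∘ ≤⇒≤ᵇ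

≤ᵇ-true⇒≤ : ∀ {m n} → (m ≤ᵇ n) ≡ true → m ≤ n
≤ᵇ-true⇒≤ {m} {n} e = ≤ᵇ⇒≤ m n (≡true⇒T e)

<⇒<ᵇ-true : ∀ {m n} → m < n → (m <ᵇ n) ≡ true
<⇒<ᵇ-true = T⇒≡true ∘ <⇒<ᵇ

>⇒≤ᵇ-false : ∀ {m n} → n < m → (m ≤ᵇ n) ≡ false
>⇒≤ᵇ-false {m} {n} n<m = ¬T⇒≡false (<⇒≱ n<m ∘ ≤ᵇ⇒≤ m n)

≥⇒<ᵇ-false : ∀ {m n} → n ≤ m → (m <ᵇ n) ≡ false
≥⇒<ᵇ-false {m} {n} n≤m = ¬T⇒≡false (≤⇒≯ n≤m ∘ <ᵇ⇒< m n)

bit-∧-monoʳ : ∀ c {a b} → (a ≡ true → b ≡ true) → bit (c ∧ a) ≤ bit (c ∧ b)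
bit-∧-monoʳ false _ = z≤n
bit-∧-monoʳ true {false} _ = z≤n
bit-∧-monoʳ true {true} a⇒b rewrite a⇒b refl = ≤-refl

any-true⁺ : ∀ {A : Set} (f : A → Bool) {x xs} → x ∈ xs → f x ≡ true → any f xs ≡ true
any-true⁺ f (here refl) fx rewrite fx = refl
any-true⁺ f {xs = y ∷ _} (there x∈xs) fx = ∨-trueʳ (f y) (any-true⁺ f x∈xs fx)

any-true⁻ : ∀ {A : Set} (f : A → Bool) xs → any f xs ≡ true → ∃ λ x → x ∈ xs × f x ≡ true
any-true⁻ f (y ∷ xs) e with ∨-true⁻ (f y) (any f xs) e
... | inj₁ fy = y , here refl , fy
... | inj₂ rest with any-true⁻ f xs rest
...   | x , x∈xs , fx = x , there x∈xs , fx

any-cong : ∀ {A : Set} {f g : A → Bool} xs → (∀ x → f x ≡ g x) → any f xs ≡ any g xs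
any-cong [] _ = refl
any-cong (y ∷ xs) f≗g = cong₂ _∨_ (f≗g y) (any-cong xs f≗g)

countᵇ : (ℕ → Bool) → List ℕ → ℕ
countᵇ f [] = 0
countᵇ f (x ∷ xs) = bit (f x) + countᵇ f xs

length-filter≡countᵇ : ∀ f xs → length (filter (T? ∘ f) xs) ≡ countᵇ f xs
length-filter≡countᵇ f [] = refl
length-filter≡countᵇ f (x ∷ xs) with f x
... | true = cong suc (length-filter≡countᵇ f xs)
... | false = length-filter≡countᵇ f xs

countᵇ-mono : ∀ {f g} xs → (∀ w → bit (f w) ≤ bit (g w)) → countᵇ f xs ≤ countᵇ g xs
countᵇ-mono [] _ = z≤n
countᵇ-mono (x ∷ xs) f≤g = +-mono-≤ (f≤g x) (countᵇ-mono xs f≤g)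

countᵇ-≤-+ : ∀ {f g h} xs → (∀ w → bit (f w) ≤ bit (g w) + bit (h w)) →
  countᵇ f xs ≤ countᵇ g xs + countᵇ h xs
countᵇ-≤-+ [] _ = z≤n
countᵇ-≤-+ {f} {g} {h} (x ∷ xs) f≤g+h = begin
  bit (f x) + countᵇ f xs
    ≤⟨ +-mono-≤ (f≤g+h x) (countᵇ-≤-+ xs f≤g+h) ⟩
  (bit (g x) + bit (h x)) + (countᵇ g xs + countᵇ h xs)
    ≡⟨ interchange (bit (g x)) (bit (h x)) (countᵇ g xs) (countᵇ h xs) ⟩
  (bit (g x) + countᵇ g xs) + (bit (h x) + countᵇ h xs) ∎
  where open ≤-Reasoning

countᵇ-none : ∀ {f} xs → (∀ x → x ∈ xs → f x ≡ false) → countᵇ f xs ≡ 0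
countᵇ-none [] _ = refl
countᵇ-none {f} (x ∷ xs) none rewrite none x (here refl) = countᵇ-none xs (λ y → none y ∘ there)

countᵇ-pos : ∀ {f x} xs → x ∈ xs → f x ≡ true → 1 ≤ countᵇ f xs
countᵇ-pos (_ ∷ _) (here refl) fx rewrite fx = s≤s z≤n
countᵇ-pos {f} (y ∷ xs) (there x∈xs) fx = ≤-trans (countᵇ-pos xs x∈xs fx) (m≤n+m _ (bit (f y)))

countᵇ-≡ᵇ≤ : ∀ c b xs → Unique xs → countᵇ (λ w → (c ≡ᵇ w) ∧ b) xs ≤ bit b
countᵇ-≡ᵇ≤ c false xs _ = ≤-reflexive (countᵇ-none xs (λ x _ → ∧-zeroʳ (c ≡ᵇ x)))
countᵇ-≡ᵇ≤ c true [] _ = z≤n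
countᵇ-≡ᵇ≤ c true (x ∷ xs) (x∉xs ∷ uniq) with c ≡ᵇ x in c≡x
... | false = countᵇ-≡ᵇ≤ c true xs uniq
... | true = s≤s (≤-reflexive (countᵇ-none xs (λ y y∈xs → c≢y (All-lookup x∉xs y∈xs))))
  where
    c≢y : ∀ {y} → x ≢ y → (c ≡ᵇ y) ∧ true ≡ false
    c≢y x≢y = trans (∧-identityʳ _) (≢⇒≡ᵇ-false {c} (x≢y ∘ trans (sym (≡ᵇ-true⇒≡ {c} c≡x))))

-- Incidence degrees

joins : ℕ → ℕ → ℕ × ℕ → Bool
joins u v e = ((proj₁ e ≡ᵇ u) ∧ (proj₂ e ≡ᵇ v)) ∨ ((proj₁ e ≡ᵇ v) ∧ (proj₂ e ≡ᵇ u))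

-- adj G is definitionally adjacentIn (E G).
adjacentIn : List (ℕ × ℕ) → ℕ → ℕ → Bool
adjacentIn es u v = any (joins u v) es

endsAt : (ℕ → Bool) → ℕ → ℕ × ℕ → ℕ
endsAt p v (x , y) = bit ((x ≡ᵇ v) ∧ p y) + bit ((y ≡ᵇ v) ∧ p x)

-- The number of edge ends at v whose opposite end satisfies p, counted with multiplicity;
-- deg es (const true) v is the degree of v.
deg : List (ℕ × ℕ) → (ℕ → Bool) → ℕ → ℕ
deg [] p v = 0
deg (e ∷ es) p v = endsAt p v e + deg es p v

EndsImply : List (ℕ × ℕ) → (ℕ → Bool) → (ℕ → Bool) → Set
EndsImply es p q = ∀ x y → (x , y) ∈ es → (p y ≡ true → q y ≡ true) × (p x ≡ true → q x ≡ true)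

deg-++ : ∀ es fs p v → deg (es ++ fs) p v ≡ deg es p v + deg fs p v
deg-++ [] fs p v = refl
deg-++ (e ∷ es) fs p v rewrite deg-++ es fs p v = sym (+-assoc (endsAt p v e) (deg es p v) (deg fs p v))

endsAt-mono : ∀ {p q} v x y → (p y ≡ true → q y ≡ true) × (p x ≡ true → q x ≡ true) →
  endsAt p v (x , y) ≤ endsAt q v (x , y)
endsAt-mono v x y (py⇒qy , px⇒qx) = +-mono-≤ (bit-∧-monoʳ (x ≡ᵇ v) py⇒qy) (bit-∧-monoʳ (y ≡ᵇ v) px⇒qx)

deg-mono : ∀ {p q} es v → EndsImply es p q → deg es p v ≤ deg es q v
deg-mono [] v _ = z≤n
deg-mono ((x , y) ∷ es) v p⇒q = +-mono-≤ (endsAt-mono v x y (p⇒q x y (here refl))) (deg-mono es v (λ x y → p⇒q x y ∘ there))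

joins-true⁻ : ∀ u v x y → joins u v (x , y) ≡ true → (x ≡ u × y ≡ v) ⊎ (x ≡ v × y ≡ u)
joins-true⁻ u v x y e with ∨-true⁻ ((x ≡ᵇ u) ∧ (y ≡ᵇ v)) _ e
... | inj₁ e′ = let x≡u , y≡v = ∧-true⁻ _ _ e′ in inj₁ (≡ᵇ-true⇒≡ x≡u , ≡ᵇ-true⇒≡ y≡v)
... | inj₂ e′ = let x≡v , y≡u = ∧-true⁻ _ _ e′ in inj₂ (≡ᵇ-true⇒≡ x≡v , ≡ᵇ-true⇒≡ y≡u)

endsAt-< : ∀ {p q} v u x y → joins v u (x , y) ≡ true → p u ≡ false → q u ≡ true →
  (p y ≡ true → q y ≡ true) × (p x ≡ true → q x ≡ true) →
  suc (endsAt p v (x , y)) ≤ endsAt q v (x , y)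
endsAt-< {p} {q} v u x y vu pu qu (_ , px⇒qx) with joins-true⁻ v u x y vu
... | inj₁ (refl , refl) rewrite ≡⇒≡ᵇ-true {x} refl | pu | qu = s≤s (bit-∧-monoʳ (y ≡ᵇ x) px⇒qx)
endsAt-< {p} {q} v u x y vu pu qu (py⇒qy , _) | inj₂ (refl , refl)
  rewrite ≡⇒≡ᵇ-true {y} refl | pu | qu | +-comm (bit ((x ≡ᵇ y) ∧ p y)) 0 | +-comm (bit ((x ≡ᵇ y) ∧ q y)) 1 =
  s≤s (bit-∧-monoʳ (x ≡ᵇ y) py⇒qy)

deg-< : ∀ {p q} es v u → adjacentIn es v u ≡ true → p u ≡ false → q u ≡ true → EndsImply es p q →
  suc (deg es p v) ≤ deg es q v
deg-< ((x , y) ∷ es) v u vu pu qu p⇒q with ∨-true⁻ (joins v u (x , y)) (adjacentIn es v u) vu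
... | inj₁ here-vu = +-mono-≤ (endsAt-< v u x y here-vu pu qu (p⇒q x y (here refl))) (deg-mono es v (λ x y → p⇒q x y ∘ there))
... | inj₂ there-vu = ≤-trans (≤-reflexive (sym (+-suc _ _)))
  (+-mono-≤ (endsAt-mono v x y (p⇒q x y (here refl))) (deg-< es v u there-vu pu qu (λ x y → p⇒q x y ∘ there)))

bit-joins∧ : ∀ x y v w (q : ℕ → Bool) →
  bit (joins v w (x , y) ∧ q w) ≤ bit ((y ≡ᵇ w) ∧ ((x ≡ᵇ v) ∧ q y)) + bit ((x ≡ᵇ w) ∧ ((y ≡ᵇ v) ∧ q x))
bit-joins∧ x y v w q with x ≡ᵇ v in e1 | y ≡ᵇ w in e2 | x ≡ᵇ w in e3 | y ≡ᵇ v in e4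
... | true | true | _ | _ rewrite ≡ᵇ-true⇒≡ {y} e2 = m≤m+n (bit (q w)) _
... | true | false | true | true rewrite ≡ᵇ-true⇒≡ {x} e3 = ≤-refl
... | false | b | true | true rewrite ≡ᵇ-true⇒≡ {x} e3 = m≤n+m (bit (q w)) (bit (b ∧ false))
... | true | false | false | _ = z≤n
... | true | false | true | false = z≤n
... | false | _ | false | _ = z≤n
... | false | _ | true | false = z≤n

bit-∨∧ : ∀ a b c → bit ((a ∨ b) ∧ c) ≤ bit (a ∧ c) + bit (b ∧ c)
bit-∨∧ true b true = s≤s z≤n
bit-∨∧ true b false = z≤n
bit-∨∧ false b c = ≤-refl

count-adjacent≤deg : ∀ es v q xs → Unique xs → countᵇ (λ w → adjacentIn es v w ∧ q w) xs ≤ deg es q v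
count-adjacent≤deg [] v q xs _ = ≤-reflexive (countᵇ-none xs (λ _ _ → refl))
count-adjacent≤deg ((x , y) ∷ es) v q xs uniq = begin
  countᵇ (λ w → adjacentIn ((x , y) ∷ es) v w ∧ q w) xs
    ≤⟨ countᵇ-≤-+ xs (λ w → bit-∨∧ (joins v w (x , y)) (adjacentIn es v w) (q w)) ⟩
  countᵇ (λ w → joins v w (x , y) ∧ q w) xs + countᵇ (λ w → adjacentIn es v w ∧ q w) xs
    ≤⟨ +-mono-≤ (≤-trans (countᵇ-≤-+ xs (λ w → bit-joins∧ x y v w q))
                         (+-mono-≤ (countᵇ-≡ᵇ≤ y _ xs uniq) (countᵇ-≡ᵇ≤ x _ xs uniq)))
                (count-adjacent≤deg es v q xs uniq) ⟩
  endsAt q v (x , y) + deg es q v ∎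
  where open ≤-Reasoning

adj-sym : ∀ G u w → adj G u w ≡ adj G w u
adj-sym G u w = any-cong (E G) (λ e → ∨-comm ((proj₁ e ≡ᵇ u) ∧ (proj₂ e ≡ᵇ w)) _)

inN-refl : ∀ G v → inN G v v ≡ true
inN-refl G v rewrite ≡⇒≡ᵇ-true {v} refl = refl

adj⇒inN : ∀ G v w → adj G v w ≡ true → inN G v w ≡ true
adj⇒inN G v w = ∨-trueʳ (v ≡ᵇ w)

edge⇒adj : ∀ G u w → (u , w) ∈ E G → adj G u w ≡ true
edge⇒adj G u w u-w = any-true⁺ (joins u w) u-w
  (cong₂ (λ s t → (s ∧ t) ∨ ((u ≡ᵇ w) ∧ (w ≡ᵇ u))) (≡⇒≡ᵇ-true {u} refl) (≡⇒≡ᵇ-true {w} refl))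

adj-step : ∀ G u w → adj G u w ≡ true → adj (step G) u w ≡ true
adj-step G u w uw with any-true⁻ (joins u w) (E G) uw
... | e , e∈E , je = any-true⁺ (joins u w) (∈-++⁺ˡ e∈E) je

outside≤deg : ∀ G S v → S v ≡ true → outside G S v ≤ deg (E G) (not ∘ S) v
outside≤deg G S v Sv = begin
  outside G S v                                       ≡⟨ length-filter≡countᵇ _ (verts G) ⟩
  countᵇ (λ w → inN G v w ∧ not (S w)) (verts G)       ≤⟨ countᵇ-mono (verts G) drop-v ⟩
  countᵇ (λ w → adj G v w ∧ not (S w)) (verts G)       ≤⟨ count-adjacent≤deg (E G) v (not ∘ S) (verts G) (upTo⁺ (n G)) ⟩
  deg (E G) (not ∘ S) v                               ∎
  where
    open ≤-Reasoning
    drop-v : ∀ w → bit (inN G v w ∧ not (S w)) ≤ bit (adj G v w ∧ not (S w))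
    drop-v w with v ≡ᵇ w in v≡w
    ... | false = ≤-refl
    ... | true rewrite sym (≡ᵇ-true⇒≡ {v} v≡w) | Sv = z≤n

outside-antitone : ∀ G {S S′} v → (∀ w → S w ≡ true → S′ w ≡ true) → outside G S′ v ≤ outside G S v
outside-antitone G {S} {S′} v S⊆S′ = begin
  outside G S′ v                                  ≡⟨ length-filter≡countᵇ _ (verts G) ⟩
  countᵇ (λ w → inN G v w ∧ not (S′ w)) (verts G)  ≤⟨ countᵇ-mono (verts G) (λ w → bit-∧-monoʳ (inN G v w) (notS′⇒notS w)) ⟩
  countᵇ (λ w → inN G v w ∧ not (S w)) (verts G)   ≡⟨ length-filter≡countᵇ _ (verts G) ⟨
  outside G S v                                   ∎
  where
    open ≤-Reasoning
    notS′⇒notS : ∀ w → not (S′ w) ≡ true → not (S w) ≡ true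
    notS′⇒notS w e with S w in Sw
    ... | false = refl
    ... | true rewrite S⊆S′ w Sw = e

-- Propagation from a single vertex

module Propagation (G : Graph) (k a : ℕ) (a∈V : a < n G) where

  S : ℕ → VSet
  S = P G k (singleton a)

  S₀⁺ : ∀ w → inN G a w ≡ true → S 0 w ≡ true
  S₀⁺ w aw = any-true⁺ (λ v → (a ≡ᵇ v) ∧ inN G v w) (∈-upTo⁺ a∈V) (trans (cong (_∧ inN G a w) (≡⇒≡ᵇ-true {a} refl)) aw)

  S₀⁻ : ∀ w → S 0 w ≡ true → inN G a w ≡ true
  S₀⁻ w S₀w with any-true⁻ (λ v → (a ≡ᵇ v) ∧ inN G v w) (verts G) S₀w
  ... | v , _ , e with ∧-true⁻ (a ≡ᵇ v) _ e
  ...   | a≡v , vw rewrite sym (≡ᵇ-true⇒≡ {a} a≡v) = vw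

  fires : ∀ i v w → v < n G → S i v ≡ true → outside G (S i) v ≤ k → inN G v w ≡ true → S (suc i) w ≡ true
  fires i v w v∈V Sv out≤k vw = any-true⁺ (λ v → S i v ∧ (outside G (S i) v ≤ᵇ k) ∧ inN G v w) (∈-upTo⁺ v∈V)
    (trans (cong₂ (λ s t → s ∧ t ∧ inN G v w) Sv (≤⇒≤ᵇ-true out≤k)) vw)

  fires⁻ : ∀ i w → S (suc i) w ≡ true →
    ∃ λ v → v < n G × S i v ≡ true × outside G (S i) v ≤ k × inN G v w ≡ true
  fires⁻ i w Sw with any-true⁻ (λ v → S i v ∧ (outside G (S i) v ≤ᵇ k) ∧ inN G v w) (verts G) Sw
  ... | v , v∈V , e with ∧-true⁻ (S i v) _ e
  ...   | Sv , e′ with ∧-true⁻ (outside G (S i) v ≤ᵇ k) _ e′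
  ...     | out≤k , vw = v , ∈-upTo⁻ v∈V , Sv , ≤ᵇ-true⇒≤ out≤k , vw

  source-fires : outside G (S 0) a ≤ k
  source-fires = subst (_≤ k) (sym (trans (length-filter≡countᵇ _ (verts G)) (countᵇ-none (verts G) all-seen))) z≤n
    where
      all-seen : ∀ w → w ∈ verts G → inN G a w ∧ not (S 0 w) ≡ false
      all-seen w _ with inN G a w in aw
      ... | false = refl
      ... | true rewrite S₀⁺ w aw = refl

  S-suc : ∀ i w → S i w ≡ true → S (suc i) w ≡ true
  S-suc zero w S₀w = fires 0 a w a∈V (S₀⁺ a (inN-refl G a)) source-fires (S₀⁻ w S₀w)
  S-suc (suc i) w Sw with fires⁻ i w Sw
  ... | v , v∈V , Sv , out≤k , vw =
    fires (suc i) v w v∈V (S-suc i v Sv) (≤-trans (outside-antitone G v (S-suc i)) out≤k) vw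

  S-mono : ∀ {i j} w → i ≤ j → S i w ≡ true → S j w ≡ true
  S-mono {j = zero} w z≤n Sw = Sw
  S-mono {j = suc j} w i≤1+j Sw with m≤n⇒m<n∨m≡n i≤1+j
  ... | inj₁ i<1+j = S-suc j w (S-mono w (≤-pred i<1+j) Sw)
  ... | inj₂ refl = Sw

  source⊎observed-neighbour : ∀ i w → S i w ≡ true → w ≡ a ⊎ (∃ λ u → u < n G × S i u ≡ true × adj G u w ≡ true)
  source⊎observed-neighbour zero w S₀w with ∨-true⁻ (a ≡ᵇ w) (adj G a w) (S₀⁻ w S₀w)
  ... | inj₁ a≡w = inj₁ (sym (≡ᵇ-true⇒≡ a≡w))
  ... | inj₂ aw = inj₂ (a , a∈V , S₀⁺ a (inN-refl G a) , aw)
  source⊎observed-neighbour (suc i) w Sw with fires⁻ i w Sw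
  ... | v , v∈V , Sv , _ , vw with ∨-true⁻ (v ≡ᵇ w) (adj G v w) vw
  ...   | inj₂ adj-vw = inj₂ (v , v∈V , S-suc i v Sv , adj-vw)
  ...   | inj₁ v≡w rewrite ≡ᵇ-true⇒≡ {v} v≡w with source⊎observed-neighbour i w Sv
  ...     | inj₁ w≡a = inj₁ w≡a
  ...     | inj₂ (u , u∈V , Su , uw) = inj₂ (u , u∈V , S-suc i u Su , uw)

  common-time : ∀ N (Q : ℕ → Set) → Decidable Q → (∀ w → w < N → Q w → P∞ G k (singleton a) w) →
    ∃ λ i → ∀ w → w < N → Q w → S i w ≡ true
  common-time zero Q Q? _ = 0 , λ _ ()
  common-time (suc N) Q Q? obs with common-time N Q Q? (λ w → obs w ∘ m<n⇒m<1+n) | Q? N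
  ... | i , below-N | no ¬QN = i , λ w w<1+N Qw → case w<1+N Qw
    where
      case : ∀ {w} → w < suc N → Q w → S i w ≡ true
      case w<1+N Qw with m<1+n⇒m<n∨m≡n w<1+N
      ... | inj₁ w<N = below-N _ w<N Qw
      ... | inj₂ refl = ⊥-elim (¬QN Qw)
  ... | i , below-N | yes QN with obs N ≤-refl QN
  ...   | j , SjN = i ⊔ j , λ w w<1+N Qw → case w<1+N Qw
    where
      case : ∀ {w} → w < suc N → Q w → S (i ⊔ j) w ≡ true
      case w<1+N Qw with m<1+n⇒m<n∨m≡n w<1+N
      ... | inj₁ w<N = S-mono _ (m≤m⊔n i j) (below-N _ w<N Qw)
      ... | inj₂ refl = S-mono _ (m≤n⊔m i j) SjN

-- Hubs and regions

data Hub : ℕ → Set where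
  hub₀ : Hub 0
  hub₁ : Hub 1
  hub₂ : Hub 2

hub : ∀ {h} → h < 3 → Hub h
hub {0} _ = hub₀
hub {1} _ = hub₁
hub {2} _ = hub₂
hub {suc (suc (suc _))} (s≤s (s≤s (s≤s ())))

third : ℕ → ℕ → ℕ
third x y = 3 ∸ (x + y)

third-hub : ∀ {x y} → Hub x → Hub y → x ≢ y → third x y < 3 × third x y ≢ x × third x y ≢ y
third-hub hub₀ hub₁ _ = s≤s (s≤s (s≤s z≤n)) , (λ ()) , (λ ())
third-hub hub₀ hub₂ _ = s≤s (s≤s z≤n) , (λ ()) , (λ ())
third-hub hub₁ hub₀ _ = s≤s (s≤s (s≤s z≤n)) , (λ ()) , (λ ())
third-hub hub₁ hub₂ _ = s≤s z≤n , (λ ()) , (λ ())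
third-hub hub₂ hub₀ _ = s≤s (s≤s z≤n) , (λ ()) , (λ ())
third-hub hub₂ hub₁ _ = s≤s z≤n , (λ ()) , (λ ())
third-hub hub₀ hub₀ x≢y = ⊥-elim (x≢y refl)
third-hub hub₁ hub₁ x≢y = ⊥-elim (x≢y refl)
third-hub hub₂ hub₂ x≢y = ⊥-elim (x≢y refl)

third-unique : ∀ {x y h} → Hub x → Hub y → Hub h → x ≢ y → h ≢ x → h ≢ y → h ≡ third x y
third-unique hub₀ hub₁ hub₂ _ _ _ = refl
third-unique hub₀ hub₂ hub₁ _ _ _ = refl
third-unique hub₁ hub₀ hub₂ _ _ _ = refl
third-unique hub₁ hub₂ hub₀ _ _ _ = refl
third-unique hub₂ hub₀ hub₁ _ _ _ = refl
third-unique hub₂ hub₁ hub₀ _ _ _ = refl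
third-unique hub₀ hub₀ _ x≢y _ _ = ⊥-elim (x≢y refl)
third-unique hub₁ hub₁ _ x≢y _ _ = ⊥-elim (x≢y refl)
third-unique hub₂ hub₂ _ x≢y _ _ = ⊥-elim (x≢y refl)
third-unique hub₀ _ hub₀ _ h≢x _ = ⊥-elim (h≢x refl)
third-unique hub₁ _ hub₁ _ h≢x _ = ⊥-elim (h≢x refl)
third-unique hub₂ _ hub₂ _ h≢x _ = ⊥-elim (h≢x refl)
third-unique _ hub₀ hub₀ _ _ h≢y = ⊥-elim (h≢y refl)
third-unique _ hub₁ hub₁ _ _ h≢y = ⊥-elim (h≢y refl)
third-unique _ hub₂ hub₂ _ _ h≢y = ⊥-elim (h≢y refl)

hub-cases : ∀ {x y h} → x < 3 → y < 3 → h < 3 → x ≢ y → h ≢ third x y → h ≡ x ⊎ h ≡ y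
hub-cases {x} {y} {h} x<3 y<3 h<3 x≢y h≢xy with h ≟ x | h ≟ y
... | yes h≡x | _ = inj₁ h≡x
... | no _ | yes h≡y = inj₂ h≡y
... | no h≢x | no h≢y = ⊥-elim (h≢xy (third-unique (hub x<3) (hub y<3) (hub h<3) x≢y h≢x h≢y))

otherHub : ℕ → ℕ
otherHub zero = 1
otherHub (suc _) = 0

otherHub<3 : ∀ a → otherHub a < 3
otherHub<3 zero = s≤s (s≤s z≤n)
otherHub<3 (suc _) = s≤s z≤n

otherHub≢ : ∀ a → otherHub a ≢ a
otherHub≢ zero ()
otherHub≢ (suc _) ()

-- Region r (in 𝒢 (m + 1), the copy of 𝒢 m avoiding hub r) consists of the inner vertices labelled r
-- and the two hubs other than r.
inRegion : (ℕ → ℕ) → ℕ → ℕ → Bool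
inRegion region r w = if w <ᵇ 3 then not (w ≡ᵇ r) else (region w ≡ᵇ r)

inRegion-hub : ∀ region r {w} → w < 3 → inRegion region r w ≡ not (w ≡ᵇ r)
inRegion-hub region r w<3 rewrite <⇒<ᵇ-true w<3 = refl

inRegion-inner : ∀ region r {w} → 3 ≤ w → inRegion region r w ≡ (region w ≡ᵇ r)
inRegion-inner region r 3≤w rewrite ≥⇒<ᵇ-false 3≤w = refl

hub∈region : ∀ region {r h} → h < 3 → h ≢ r → inRegion region r h ≡ true
hub∈region region {r} h<3 h≢r = trans (inRegion-hub region r h<3) (cong not (≢⇒≡ᵇ-false h≢r))

hub∈region⁻ : ∀ region {r h} → h < 3 → inRegion region r h ≡ true → h ≢ r
hub∈region⁻ region {r} h<3 h∈r h≡r = not-¬ (sym (≡⇒≡ᵇ-true h≡r)) (sym (trans (sym (inRegion-hub region r h<3)) h∈r))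

inner∈region : ∀ region {r w} → 3 ≤ w → region w ≡ r → inRegion region r w ≡ true
inner∈region region {r} 3≤w w∈r = trans (inRegion-inner region r 3≤w) (≡⇒≡ᵇ-true w∈r)

inner∈region⁻ : ∀ region {r w} → 3 ≤ w → inRegion region r w ≡ true → region w ≡ r
inner∈region⁻ region {r} 3≤w w∈r = ≡ᵇ-true⇒≡ (trans (sym (inRegion-inner region r 3≤w)) w∈r)

data EdgeShape (region : ℕ → ℕ) (x y : ℕ) : Set where
  hub-hub : x < 3 → y < 3 → x ≢ y → EdgeShape region x y
  hub-inner : x < 3 → 3 ≤ y → region y ≢ x → EdgeShape region x y
  inner-hub : 3 ≤ x → y < 3 → region x ≢ y → EdgeShape region x y
  inner-inner : 3 ≤ x → 3 ≤ y → region x ≡ region y → EdgeShape region x y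

data Anchored (G : Graph) (region : ℕ → ℕ) (y : ℕ) : Set where
  on-hubs : (∀ h → h < 3 → h ≢ region y → adj G h y ≡ true) → Anchored G region y
  on-earlier : ∀ z → 3 ≤ z → z < y → region z ≡ region y → adj G z y ≡ true → Anchored G region y

record HubStructure (G : Graph) (K : ℕ) : Set where
  field
    region : ℕ → ℕ
    hubs∈V : 3 ≤ n G
    1≤K : 1 ≤ K
    hubs-adjacent : ∀ h h′ → h < 3 → h′ < 3 → h ≢ h′ → adj G h h′ ≡ true
    ends∈V : ∀ x y → (x , y) ∈ E G → x < n G × y < n G
    edge-shape : ∀ x y → (x , y) ∈ E G → EdgeShape region x y
    region<3 : ∀ y → 3 ≤ y → y < n G → region y < 3
    anchored : ∀ y → 3 ≤ y → y < n G → Anchored G region y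
    inner-deg≤ : ∀ y → 3 ≤ y → y < n G → deg (E G) (const true) y ≤ K
    hub-region-deg≤ : ∀ h r → h < 3 → r < 3 → h ≢ r → deg (E G) (inRegion region r) h ≤ K

module Observation {G K} (H : HubStructure G K) (k : ℕ) (K≤1+k : K ≤ suc k) (a : ℕ) (a<3 : a < 3) where
  open HubStructure H
  open Propagation G k a (<-≤-trans a<3 hubs∈V)

  Observed : ℕ → Set
  Observed = P∞ G k (singleton a)

  hubs-observed : ∀ i h → h < 3 → S i h ≡ true
  hubs-observed i h h<3 = S-mono {j = i} h z≤n (S₀⁺ h a-sees-h)
    where
      a-sees-h : inN G a h ≡ true
      a-sees-h with a ≟ h
      ... | yes refl = inN-refl G a
      ... | no a≢h = adj⇒inN G a h (hubs-adjacent a h a<3 h<3 a≢h)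

  -- An observed inner vertex already has an observed neighbour, so at most K - 1 unobserved ones.
  inner-fires : ∀ i z w → 3 ≤ z → z < n G → S i z ≡ true → adj G z w ≡ true → S (suc i) w ≡ true
  inner-fires i z w 3≤z z∈V Sz zw with source⊎observed-neighbour i z Sz
  ... | inj₁ refl = ⊥-elim (<⇒≱ a<3 3≤z)
  ... | inj₂ (u , _ , Su , uz) = fires i z w z∈V Sz out≤k (adj⇒inN G z w zw)
    where
      unobserved<deg : suc (deg (E G) (not ∘ S i) z) ≤ deg (E G) (const true) z
      unobserved<deg = deg-< (E G) z u (trans (adj-sym G z u) uz) (cong not Su) refl (λ _ _ _ → const refl , const refl)
      out≤k : outside G (S i) z ≤ k
      out≤k = ≤-trans (outside≤deg G (S i) z Sz) (≤-pred (≤-trans unobserved<deg (≤-trans (inner-deg≤ z 3≤z z∈V) K≤1+k)))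

  region-observed : ∀ s r → s < 3 → s ≢ r → (∀ w → adj G s w ≡ true → Observed w) →
    ∀ y → 3 ≤ y → y < n G → region y ≡ r → Observed y
  region-observed s r s<3 s≢r s-observes = <-rec (λ y → 3 ≤ y → y < n G → region y ≡ r → Observed y) induction-step
    where
      induction-step : ∀ y → (∀ {z} → z < y → 3 ≤ z → z < n G → region z ≡ r → Observed z) → 3 ≤ y → y < n G → region y ≡ r → Observed y
      induction-step y earlier 3≤y y∈V refl with anchored y 3≤y y∈V
      ... | on-hubs hubs-see-y = s-observes y (hubs-see-y s s<3 s≢r)
      ... | on-earlier z 3≤z z<y same zy with earlier z<y 3≤z (<-trans z<y y∈V) same
      ...   | i , Sz = suc i , inner-fires i z y 3≤z (<-trans z<y y∈V) Sz zy

  other-regions-observed : ∃ λ i → ∀ w → w < n G → 3 ≤ w × region w ≢ a → S i w ≡ true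
  other-regions-observed = common-time (n G) _ (λ w → (3 ≤? w) ×-dec ¬? (region w ≟ a)) observed
    where
      observed : ∀ w → w < n G → 3 ≤ w × region w ≢ a → Observed w
      observed w w∈V (3≤w , w∉a) = region-observed a (region w) a<3 (w∉a ∘ sym)
        (λ v av → 0 , S₀⁺ v (adj⇒inN G a v av)) w 3≤w w∈V refl

  i₀ : ℕ
  i₀ = proj₁ other-regions-observed

  unobserved⇒in-region-a : ∀ w → w < n G → not (S i₀ w) ≡ true → inRegion region a w ≡ true
  unobserved⇒in-region-a w w∈V unobs with 3 ≤? w
  ... | no w≱3 = ⊥-elim (not-¬ (sym (hubs-observed i₀ w (≰⇒> w≱3))) (sym unobs))
  ... | yes 3≤w with region w ≟ a
  ... | yes w∈a = inner∈region region 3≤w w∈a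
  ... | no w∉a = ⊥-elim (not-¬ (sym (proj₂ other-regions-observed w w∈V (3≤w , w∉a))) (sym unobs))

  b c : ℕ
  b = otherHub a
  c = third a b

  b<3 : b < 3
  b<3 = otherHub<3 a

  c-hub : c < 3 × c ≢ a × c ≢ b
  c-hub = third-hub (hub a<3) (hub b<3) (otherHub≢ a ∘ sym)

  -- The unobserved neighbours of hub b are inner vertices of region a, which also contains the
  -- observed hub c.
  b-fires : ∀ w → adj G b w ≡ true → S (suc i₀) w ≡ true
  b-fires w bw = fires i₀ b w (<-≤-trans b<3 hubs∈V) (hubs-observed i₀ b b<3) out≤k (adj⇒inN G b w bw)
    where
      c<3 : c < 3
      c<3 = proj₁ c-hub
      unobserved<region : suc (deg (E G) (not ∘ S i₀) b) ≤ deg (E G) (inRegion region a) b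
      unobserved<region = deg-< (E G) b c
        (hubs-adjacent b c b<3 c<3 (proj₂ (proj₂ c-hub) ∘ sym))
        (cong not (hubs-observed i₀ c c<3))
        (hub∈region region c<3 (proj₁ (proj₂ c-hub)))
        (λ x y x-y → let x∈V , y∈V = ends∈V x y x-y in unobserved⇒in-region-a y y∈V , unobserved⇒in-region-a x x∈V)
      out≤k : outside G (S i₀) b ≤ k
      out≤k = ≤-trans (outside≤deg G (S i₀) b (hubs-observed i₀ b b<3))
        (≤-pred (≤-trans unobserved<region (≤-trans (hub-region-deg≤ b a b<3 a<3 (otherHub≢ a)) K≤1+k)))

  single-hub-dominates : IsKPDS G k (singleton a)
  single-hub-dominates w w∈V with 3 ≤? w
  ... | no w≱3 = 0 , hubs-observed 0 w (≰⇒> w≱3)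
  ... | yes 3≤w with region w ≟ a
  ... | no w∉a = i₀ , proj₂ other-regions-observed w w∈V (3≤w , w∉a)
  ... | yes w∈a = region-observed b a b<3 (otherHub≢ a) (λ v bv → suc i₀ , b-fires v bv) w 3≤w w∈V w∈a

-- Subdividing every edge

Labels : (ℕ → ℕ) → (ℕ × ℕ → ℕ) → ℕ → List (ℕ × ℕ) → Set
Labels ρ f m [] = ⊤
Labels ρ f m (e ∷ F) = ρ m ≡ f e × Labels ρ f (suc m) F

Guards : (ℕ → Bool) → (ℕ → Bool) → ℕ → List (ℕ × ℕ) → Set
Guards p q m [] = ⊤
Guards p q m ((x , y) ∷ F) = (p m ≡ true → q x ≡ true × q y ≡ true) × Guards p q (suc m) F

NoEnd : List (ℕ × ℕ) → ℕ → Set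
NoEnd F y = ∀ x x′ → (x , x′) ∈ F → x ≢ y × x′ ≢ y

module _ {ρ : ℕ → ℕ} {f : ℕ × ℕ → ℕ} where

  ∈-newEdges⁻ : ∀ m F → Labels ρ f m F → ∀ e → e ∈ newEdges m F →
    ∃ λ x → ∃ λ y → ∃ λ z → (x , y) ∈ F × m ≤ z × z < m + length F × ρ z ≡ f (x , y) × (e ≡ (x , z) ⊎ e ≡ (y , z))
  ∈-newEdges⁻ m ((x , y) ∷ F) (ρm , _) e (here refl) = x , y , m , here refl , ≤-refl , m<m+n m z<s , ρm , inj₁ refl
  ∈-newEdges⁻ m ((x , y) ∷ F) (ρm , _) e (there (here refl)) = x , y , m , here refl , ≤-refl , m<m+n m z<s , ρm , inj₂ refl
  ∈-newEdges⁻ m ((x , y) ∷ F) (_ , labels) e (there (there e∈)) with ∈-newEdges⁻ (suc m) F labels e e∈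
  ... | x′ , y′ , z , xy∈F , m<z , z<end , ρz , e≡ =
    x′ , y′ , z , there xy∈F , <⇒≤ m<z , subst (z <_) (sym (+-suc m (length F))) z<end , ρz , e≡

  newVertex-edges : ∀ m F → Labels ρ f m F → ∀ z → m ≤ z → z < m + length F →
    ∃ λ x → ∃ λ y → (x , y) ∈ F × ρ z ≡ f (x , y) × (x , z) ∈ newEdges m F × (y , z) ∈ newEdges m F
  newVertex-edges m [] _ z m≤z z<m+0 = ⊥-elim (<⇒≱ z<m+0 (subst (_≤ z) (sym (+-identityʳ m)) m≤z))
  newVertex-edges m ((x , y) ∷ F) (ρm , labels) z m≤z z<end with z ≟ m
  ... | yes refl = x , y , here refl , ρm , here refl , there (here refl)
  ... | no z≢m with newVertex-edges (suc m) F labels z (≤∧≢⇒< m≤z (z≢m ∘ sym)) (subst (z <_) (+-suc m (length F)) z<end)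
  ...   | x′ , y′ , xy∈F , ρz , xz∈ , yz∈ = x′ , y′ , there xy∈F , ρz , there (there xz∈) , there (there yz∈)

guards-true : ∀ m F → Guards (const true) (const true) m F
guards-true m [] = tt
guards-true m ((x , y) ∷ F) = const (refl , refl) , guards-true (suc m) F

deg-newEdges-old : ∀ {p q} m F h → h < m → Guards p q m F → deg (newEdges m F) p h ≤ deg F q h
deg-newEdges-old m [] h _ _ = z≤n
deg-newEdges-old {p} {q} m ((x , y) ∷ F) h h<m (guard , guards) rewrite ≢⇒≡ᵇ-false {m} {h} (>⇒≢ h<m) = begin
  (bit ((x ≡ᵇ h) ∧ p m) + 0) + ((bit ((y ≡ᵇ h) ∧ p m) + 0) + deg (newEdges (suc m) F) p h)
    ≡⟨ cong₂ (λ s t → s + (t + deg (newEdges (suc m) F) p h)) (+-identityʳ (bit ((x ≡ᵇ h) ∧ p m))) (+-identityʳ (bit ((y ≡ᵇ h) ∧ p m))) ⟩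
  bit ((x ≡ᵇ h) ∧ p m) + (bit ((y ≡ᵇ h) ∧ p m) + deg (newEdges (suc m) F) p h)
    ≡⟨ +-assoc (bit ((x ≡ᵇ h) ∧ p m)) _ _ ⟨
  bit ((x ≡ᵇ h) ∧ p m) + bit ((y ≡ᵇ h) ∧ p m) + deg (newEdges (suc m) F) p h
    ≤⟨ +-mono-≤ (+-mono-≤ (bit-∧-monoʳ (x ≡ᵇ h) (proj₂ ∘ guard)) (bit-∧-monoʳ (y ≡ᵇ h) (proj₁ ∘ guard)))
                (deg-newEdges-old (suc m) F h (m<n⇒m<1+n h<m) guards) ⟩
  endsAt q h (x , y) + deg F q h ∎
  where open ≤-Reasoning

deg-no-ends : ∀ F p y → NoEnd F y → deg F p y ≡ 0
deg-no-ends [] p y _ = refl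
deg-no-ends ((x , x′) ∷ F) p y no-end
  rewrite ≢⇒≡ᵇ-false (proj₁ (no-end x x′ (here refl))) | ≢⇒≡ᵇ-false (proj₂ (no-end x x′ (here refl))) =
  deg-no-ends F p y (λ x x′ → no-end x x′ ∘ there)

deg-newEdges-below : ∀ m F p y → y < m → NoEnd F y → deg (newEdges m F) p y ≡ 0
deg-newEdges-below m [] p y _ _ = refl
deg-newEdges-below m ((x , x′) ∷ F) p y y<m no-end
  rewrite ≢⇒≡ᵇ-false (proj₁ (no-end x x′ (here refl))) | ≢⇒≡ᵇ-false (proj₂ (no-end x x′ (here refl)))
        | ≢⇒≡ᵇ-false {m} {y} (>⇒≢ y<m) =
  deg-newEdges-below (suc m) F p y (m<n⇒m<1+n y<m) (λ x x′ → no-end x x′ ∘ there)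

deg-newEdges-new : ∀ m F p y → NoEnd F y → deg (newEdges m F) p y ≤ 2
deg-newEdges-new m [] p y _ = z≤n
deg-newEdges-new m ((x , x′) ∷ F) p y no-end
  rewrite ≢⇒≡ᵇ-false (proj₁ (no-end x x′ (here refl))) | ≢⇒≡ᵇ-false (proj₂ (no-end x x′ (here refl))) with m ≟ y
... | no m≢y rewrite ≢⇒≡ᵇ-false m≢y = deg-newEdges-new (suc m) F p y (λ x x′ → no-end x x′ ∘ there)
... | yes refl rewrite ≡⇒≡ᵇ-true {m} refl | deg-newEdges-below (suc m) F p m ≤-refl (λ x x′ → no-end x x′ ∘ there)
                     | +-identityʳ (bit (p x′)) = +-mono-≤ (bit≤1 (p x)) (bit≤1 (p x′))

+≤2* : ∀ {a b K} → a ≤ K → b ≤ K → a + b ≤ 2 * K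
+≤2* {K = K} a≤K b≤K = +-mono-≤ a≤K (≤-trans b≤K (≤-reflexive (sym (+-identityʳ K))))

module Subdivision {G K} (H : HubStructure G K) where
  open HubStructure H

  -- The region of the vertex subdividing an edge: the common region of its ends.
  subdivRegion : ℕ × ℕ → ℕ
  subdivRegion (x , y) = if 3 ≤ᵇ x then region x else if 3 ≤ᵇ y then region y else third x y

  regionAt : ℕ → List (ℕ × ℕ) → ℕ → ℕ
  regionAt m [] y = 0
  regionAt m (e ∷ F) y = if y ≡ᵇ m then subdivRegion e else regionAt (suc m) F y

  region′ : ℕ → ℕ
  region′ y = if y <ᵇ n G then region y else regionAt (n G) (E G) y

  G′ : Graph
  G′ = step G

  region′-old : ∀ {y} → y < n G → region′ y ≡ region y
  region′-old y<n rewrite <⇒<ᵇ-true y<n = refl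

  inRegion′-old : ∀ r {w} → w < n G → inRegion region′ r w ≡ inRegion region r w
  inRegion′-old r {w} w<n = cong (λ t → if w <ᵇ 3 then not (w ≡ᵇ r) else (t ≡ᵇ r)) (region′-old w<n)

  labels-from : ∀ m F → (∀ y → m ≤ y → region′ y ≡ regionAt m F y) → Labels region′ subdivRegion m F
  labels-from m [] _ = tt
  labels-from m (e ∷ F) agree =
    trans (agree m ≤-refl) (cong (λ b → if b then subdivRegion e else regionAt (suc m) F m) (≡⇒≡ᵇ-true {m} refl)) ,
    labels-from (suc m) F (λ y m<y → trans (agree y (<⇒≤ m<y))
      (cong (λ b → if b then subdivRegion e else regionAt (suc m) F y) (≢⇒≡ᵇ-false (>⇒≢ m<y))))

  labels : Labels region′ subdivRegion (n G) (E G)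
  labels = labels-from (n G) (E G) (λ y n≤y → cong (λ b → if b then region y else regionAt (n G) (E G) y) (≥⇒<ᵇ-false n≤y))

  subdivRegion-inner : ∀ x y → 3 ≤ x → subdivRegion (x , y) ≡ region x
  subdivRegion-inner x y 3≤x rewrite ≤⇒≤ᵇ-true 3≤x = refl

  subdivRegion-hub-inner : ∀ x y → x < 3 → 3 ≤ y → subdivRegion (x , y) ≡ region y
  subdivRegion-hub-inner x y x<3 3≤y rewrite >⇒≤ᵇ-false x<3 | ≤⇒≤ᵇ-true 3≤y = refl

  subdivRegion-hubs : ∀ x y → x < 3 → y < 3 → subdivRegion (x , y) ≡ third x y
  subdivRegion-hubs x y x<3 y<3 rewrite >⇒≤ᵇ-false x<3 | >⇒≤ᵇ-false y<3 = refl

  ends∈subdivRegion : ∀ x y → (x , y) ∈ E G →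
    inRegion region (subdivRegion (x , y)) x ≡ true × inRegion region (subdivRegion (x , y)) y ≡ true
  ends∈subdivRegion x y x-y with edge-shape x y x-y
  ... | hub-hub x<3 y<3 x≢y rewrite subdivRegion-hubs x y x<3 y<3 =
    let _ , t≢x , t≢y = third-hub (hub x<3) (hub y<3) x≢y
    in hub∈region region x<3 (t≢x ∘ sym) , hub∈region region y<3 (t≢y ∘ sym)
  ... | hub-inner x<3 3≤y ry≢x rewrite subdivRegion-hub-inner x y x<3 3≤y =
    hub∈region region x<3 (ry≢x ∘ sym) , inner∈region region 3≤y refl
  ... | inner-hub 3≤x y<3 rx≢y rewrite subdivRegion-inner x y 3≤x =
    inner∈region region 3≤x refl , hub∈region region y<3 (rx≢y ∘ sym)
  ... | inner-inner 3≤x 3≤y rx≡ry rewrite subdivRegion-inner x y 3≤x =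
    inner∈region region 3≤x refl , inner∈region region 3≤y (sym rx≡ry)

  subdivRegion<3 : ∀ x y → (x , y) ∈ E G → subdivRegion (x , y) < 3
  subdivRegion<3 x y x-y with edge-shape x y x-y
  ... | hub-hub x<3 y<3 x≢y rewrite subdivRegion-hubs x y x<3 y<3 = proj₁ (third-hub (hub x<3) (hub y<3) x≢y)
  ... | hub-inner x<3 3≤y _ rewrite subdivRegion-hub-inner x y x<3 3≤y = region<3 y 3≤y (proj₂ (ends∈V x y x-y))
  ... | inner-hub 3≤x _ _ rewrite subdivRegion-inner x y 3≤x = region<3 x 3≤x (proj₁ (ends∈V x y x-y))
  ... | inner-inner 3≤x _ _ rewrite subdivRegion-inner x y 3≤x = region<3 x 3≤x (proj₁ (ends∈V x y x-y))

  nG≤nG′ : n G ≤ n G′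
  nG≤nG′ = m≤m+n (n G) (length (E G))

  new⇒∈E′ : ∀ {e} → e ∈ newEdges (n G) (E G) → e ∈ E G′
  new⇒∈E′ = ∈-++⁺ʳ (E G)

  no-old-ends : ∀ y → n G ≤ y → NoEnd (E G) y
  no-old-ends y n≤y x x′ x-x′ = (λ x≡y → <⇒≱ (proj₁ (ends∈V x x′ x-x′)) (subst (n G ≤_) (sym x≡y) n≤y)) ,
                                (λ x′≡y → <⇒≱ (proj₂ (ends∈V x x′ x-x′)) (subst (n G ≤_) (sym x′≡y) n≤y))

  old-shape : ∀ x y → x < n G → y < n G → EdgeShape region x y → EdgeShape region′ x y
  old-shape x y x<n y<n (hub-hub x<3 y<3 x≢y) = hub-hub x<3 y<3 x≢y
  old-shape x y x<n y<n (hub-inner x<3 3≤y ry≢x) = hub-inner x<3 3≤y (ry≢x ∘ trans (sym (region′-old y<n)))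
  old-shape x y x<n y<n (inner-hub 3≤x y<3 rx≢y) = inner-hub 3≤x y<3 (rx≢y ∘ trans (sym (region′-old x<n)))
  old-shape x y x<n y<n (inner-inner 3≤x 3≤y rx≡ry) =
    inner-inner 3≤x 3≤y (trans (region′-old x<n) (trans rx≡ry (sym (region′-old y<n))))

  new-shape : ∀ x z → x < n G → n G ≤ z → inRegion region (region′ z) x ≡ true → EdgeShape region′ x z
  new-shape x z x<n n≤z x∈ with 3 ≤? x
  ... | no x≱3 = hub-inner (≰⇒> x≱3) (≤-trans hubs∈V n≤z) (hub∈region⁻ region (≰⇒> x≱3) x∈ ∘ sym)
  ... | yes 3≤x = inner-inner 3≤x (≤-trans hubs∈V n≤z) (trans (region′-old x<n) (inner∈region⁻ region 3≤x x∈))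

  edge-shape′ : ∀ x y → (x , y) ∈ E G′ → EdgeShape region′ x y
  edge-shape′ x y x-y with ∈-++⁻ (E G) x-y
  ... | inj₁ old = old-shape x y (proj₁ (ends∈V x y old)) (proj₂ (ends∈V x y old)) (edge-shape x y old)
  ... | inj₂ new with ∈-newEdges⁻ (n G) (E G) labels (x , y) new
  ...   | x₀ , y₀ , z , xy∈ , n≤z , _ , ρz , e≡ with ends∈subdivRegion x₀ y₀ xy∈ | e≡
  ...     | x₀∈ , _ | inj₁ refl = new-shape x₀ z (proj₁ (ends∈V x₀ y₀ xy∈)) n≤z (subst (λ r → inRegion region r x₀ ≡ true) (sym ρz) x₀∈)
  ...     | _ , y₀∈ | inj₂ refl = new-shape y₀ z (proj₂ (ends∈V x₀ y₀ xy∈)) n≤z (subst (λ r → inRegion region r y₀ ≡ true) (sym ρz) y₀∈)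

  ends∈V′ : ∀ x y → (x , y) ∈ E G′ → x < n G′ × y < n G′
  ends∈V′ x y x-y with ∈-++⁻ (E G) x-y
  ... | inj₁ old = <-≤-trans (proj₁ (ends∈V x y old)) nG≤nG′ , <-≤-trans (proj₂ (ends∈V x y old)) nG≤nG′
  ... | inj₂ new with ∈-newEdges⁻ (n G) (E G) labels (x , y) new
  ...   | x₀ , y₀ , z , xy∈ , _ , z<n′ , _ , inj₁ refl = <-≤-trans (proj₁ (ends∈V x₀ y₀ xy∈)) nG≤nG′ , z<n′
  ...   | x₀ , y₀ , z , xy∈ , _ , z<n′ , _ , inj₂ refl = <-≤-trans (proj₂ (ends∈V x₀ y₀ xy∈)) nG≤nG′ , z<n′

  region<3′ : ∀ y → 3 ≤ y → y < n G′ → region′ y < 3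
  region<3′ y 3≤y y<n′ with y <? n G
  ... | yes y<n rewrite region′-old y<n = region<3 y 3≤y y<n
  ... | no y≮n with newVertex-edges (n G) (E G) labels y (≮⇒≥ y≮n) y<n′
  ...   | x₀ , y₀ , xy∈ , ρy , _ rewrite ρy = subdivRegion<3 x₀ y₀ xy∈

  via-earlier : ∀ y {e} → n G ≤ y → region′ y ≡ subdivRegion e → ∀ z → 3 ≤ z → z < n G → region z ≡ subdivRegion e →
    (z , y) ∈ newEdges (n G) (E G) → Anchored G′ region′ y
  via-earlier y n≤y ry z 3≤z z<n rz zy =
    on-earlier z 3≤z (<-≤-trans z<n n≤y) (trans (region′-old z<n) (trans rz (sym ry))) (edge⇒adj G′ z y (new⇒∈E′ zy))

  anchored′ : ∀ y → 3 ≤ y → y < n G′ → Anchored G′ region′ y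
  anchored′ y 3≤y y<n′ with y <? n G
  ... | yes y<n with anchored y 3≤y y<n
  ...   | on-hubs hubs-see-y = on-hubs λ h h<3 h≢ry → adj-step G h y (hubs-see-y h h<3 (h≢ry ∘ flip-region))
    where
      flip-region : ∀ {h} → h ≡ region y → h ≡ region′ y
      flip-region h≡ry = trans h≡ry (sym (region′-old y<n))
  ...   | on-earlier z 3≤z z<y same zy =
    on-earlier z 3≤z z<y (trans (region′-old (<-trans z<y y<n)) (trans same (sym (region′-old y<n)))) (adj-step G z y zy)
  anchored′ y 3≤y y<n′ | no y≮n with newVertex-edges (n G) (E G) labels y (≮⇒≥ y≮n) y<n′
  ... | x₀ , y₀ , xy∈ , ρy , x₀y , y₀y with edge-shape x₀ y₀ xy∈
  ...   | hub-hub x<3 y<3 x≢y = on-hubs λ h h<3 h≢ry → adjacent h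
    (hub-cases x<3 y<3 h<3 x≢y (h≢ry ∘ λ h≡t → trans h≡t (sym (trans ρy (subdivRegion-hubs x₀ y₀ x<3 y<3)))))
    where
      adjacent : ∀ h → h ≡ x₀ ⊎ h ≡ y₀ → adj G′ h y ≡ true
      adjacent h (inj₁ refl) = edge⇒adj G′ h y (new⇒∈E′ x₀y)
      adjacent h (inj₂ refl) = edge⇒adj G′ h y (new⇒∈E′ y₀y)
  ...   | hub-inner x<3 3≤y₀ _ = via-earlier y {x₀ , y₀} (≮⇒≥ y≮n) ρy y₀ 3≤y₀ (proj₂ (ends∈V x₀ y₀ xy∈)) (sym (subdivRegion-hub-inner x₀ y₀ x<3 3≤y₀)) y₀y
  ...   | inner-hub 3≤x₀ _ _ = via-earlier y {x₀ , y₀} (≮⇒≥ y≮n) ρy x₀ 3≤x₀ (proj₁ (ends∈V x₀ y₀ xy∈)) (sym (subdivRegion-inner x₀ y₀ 3≤x₀)) x₀y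
  ...   | inner-inner 3≤x₀ _ _ = via-earlier y {x₀ , y₀} (≮⇒≥ y≮n) ρy x₀ 3≤x₀ (proj₁ (ends∈V x₀ y₀ xy∈)) (sym (subdivRegion-inner x₀ y₀ 3≤x₀)) x₀y

  region-guards : ∀ r m F → 3 ≤ m → Labels region′ subdivRegion m F →
    (∀ x y → (x , y) ∈ F → inRegion region (subdivRegion (x , y)) x ≡ true × inRegion region (subdivRegion (x , y)) y ≡ true) →
    Guards (inRegion region′ r) (inRegion region r) m F
  region-guards r m [] _ _ _ = tt
  region-guards r m ((x , y) ∷ F) 3≤m (ρm , labels) ends∈ =
    guard , region-guards r (suc m) F (m≤n⇒m≤1+n 3≤m) labels (λ x y → ends∈ x y ∘ there)
    where
      guard : inRegion region′ r m ≡ true → inRegion region r x ≡ true × inRegion region r y ≡ true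
      guard m∈r = subst (λ t → inRegion region t x ≡ true × inRegion region t y ≡ true)
        (trans (sym ρm) (inner∈region⁻ region′ 3≤m m∈r)) (ends∈ x y (here refl))

  -- Every old edge at h is doubled by subdivision, so degrees of old vertices at most double.
  hub-region-deg≤′ : ∀ h r → h < 3 → r < 3 → h ≢ r → deg (E G′) (inRegion region′ r) h ≤ 2 * K
  hub-region-deg≤′ h r h<3 r<3 h≢r rewrite deg-++ (E G) (newEdges (n G) (E G)) (inRegion region′ r) h = +≤2*
    (≤-trans (deg-mono (E G) h same-region) (hub-region-deg≤ h r h<3 r<3 h≢r))
    (≤-trans (deg-newEdges-old (n G) (E G) h (<-≤-trans h<3 hubs∈V) (region-guards r (n G) (E G) hubs∈V labels ends∈subdivRegion))
             (hub-region-deg≤ h r h<3 r<3 h≢r))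
    where
      same-region : EndsImply (E G) (inRegion region′ r) (inRegion region r)
      same-region x y x-y = let x<n , y<n = ends∈V x y x-y in
        trans (sym (inRegion′-old r y<n)) , trans (sym (inRegion′-old r x<n))

  inner-deg≤′ : ∀ y → 3 ≤ y → y < n G′ → deg (E G′) (const true) y ≤ 2 * K
  inner-deg≤′ y 3≤y y<n′ rewrite deg-++ (E G) (newEdges (n G) (E G)) (const true) y with y <? n G
  ... | yes y<n = +≤2* (inner-deg≤ y 3≤y y<n)
    (≤-trans (deg-newEdges-old (n G) (E G) y y<n (guards-true (n G) (E G))) (inner-deg≤ y 3≤y y<n))
  ... | no y≮n rewrite deg-no-ends (E G) (const true) y (no-old-ends y (≮⇒≥ y≮n)) =
    ≤-trans (deg-newEdges-new (n G) (E G) (const true) y (no-old-ends y (≮⇒≥ y≮n))) (*-monoʳ-≤ 2 1≤K)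

  structure : HubStructure G′ (2 * K)
  structure = record
    { region = region′
    ; hubs∈V = ≤-trans hubs∈V nG≤nG′
    ; 1≤K = ≤-trans 1≤K (m≤m+n K (K + 0))
    ; hubs-adjacent = λ h h′ h<3 h′<3 h≢h′ → adj-step G h h′ (hubs-adjacent h h′ h<3 h′<3 h≢h′)
    ; ends∈V = ends∈V′
    ; edge-shape = edge-shape′
    ; region<3 = region<3′
    ; anchored = anchored′
    ; inner-deg≤ = inner-deg≤′
    ; hub-region-deg≤ = hub-region-deg≤′
    }

triangle-structure : HubStructure triangle 1
triangle-structure = record
  { region = const 0
  ; hubs∈V = ≤-refl
  ; 1≤K = ≤-refl
  ; hubs-adjacent = λ h h′ h<3 h′<3 → adjacent (hub h<3) (hub h′<3)
  ; ends∈V = ends∈V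
  ; edge-shape = edge-shape
  ; region<3 = λ y 3≤y y<3 → ⊥-elim (<⇒≱ y<3 3≤y)
  ; anchored = λ y 3≤y y<3 → ⊥-elim (<⇒≱ y<3 3≤y)
  ; inner-deg≤ = λ y 3≤y y<3 → ⊥-elim (<⇒≱ y<3 3≤y)
  ; hub-region-deg≤ = λ h r h<3 r<3 → region-deg≤ (hub h<3) (hub r<3)
  }
  where
    adjacent : ∀ {h h′} → Hub h → Hub h′ → h ≢ h′ → adj triangle h h′ ≡ true
    adjacent hub₀ hub₁ _ = refl
    adjacent hub₀ hub₂ _ = refl
    adjacent hub₁ hub₀ _ = refl
    adjacent hub₁ hub₂ _ = refl
    adjacent hub₂ hub₀ _ = refl
    adjacent hub₂ hub₁ _ = refl
    adjacent hub₀ hub₀ h≢h′ = ⊥-elim (h≢h′ refl)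
    adjacent hub₁ hub₁ h≢h′ = ⊥-elim (h≢h′ refl)
    adjacent hub₂ hub₂ h≢h′ = ⊥-elim (h≢h′ refl)
    region-deg≤ : ∀ {h r} → Hub h → Hub r → h ≢ r → deg (E triangle) (inRegion (const 0) r) h ≤ 1
    region-deg≤ hub₀ hub₁ _ = ≤-refl
    region-deg≤ hub₀ hub₂ _ = ≤-refl
    region-deg≤ hub₁ hub₀ _ = ≤-refl
    region-deg≤ hub₁ hub₂ _ = ≤-refl
    region-deg≤ hub₂ hub₀ _ = ≤-refl
    region-deg≤ hub₂ hub₁ _ = ≤-refl
    region-deg≤ hub₀ hub₀ h≢r = ⊥-elim (h≢r refl)
    region-deg≤ hub₁ hub₁ h≢r = ⊥-elim (h≢r refl)
    region-deg≤ hub₂ hub₂ h≢r = ⊥-elim (h≢r refl)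
    ends∈V : ∀ x y → (x , y) ∈ E triangle → x < 3 × y < 3
    ends∈V _ _ (here refl) = s≤s z≤n , s≤s (s≤s z≤n)
    ends∈V _ _ (there (here refl)) = s≤s (s≤s z≤n) , ≤-refl
    ends∈V _ _ (there (there (here refl))) = s≤s z≤n , ≤-refl
    edge-shape : ∀ x y → (x , y) ∈ E triangle → EdgeShape (const 0) x y
    edge-shape x y x-y = let x<3 , y<3 = ends∈V x y x-y in hub-hub x<3 y<3 (distinct x-y)
      where
        distinct : ∀ {x y} → (x , y) ∈ E triangle → x ≢ y
        distinct (here refl) = λ ()
        distinct (there (here refl)) = λ ()
        distinct (there (there (here refl))) = λ ()

𝒢-structure : ∀ m → HubStructure (𝒢 (suc m)) (2 ^ m)
𝒢-structure zero = triangle-structure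
𝒢-structure (suc m) = Subdivision.structure (𝒢-structure m)

P⇒source : ∀ G k D i w → P G k D i w ≡ true → ∃ λ v → v ∈ verts G × D v ≡ true
P⇒source G k D zero w Pw with any-true⁻ (λ v → D v ∧ inN G v w) (verts G) Pw
... | v , v∈V , e = v , v∈V , proj₁ (∧-true⁻ (D v) _ e)
P⇒source G k D (suc i) w Pw with any-true⁻ (λ v → P G k D i v ∧ (outside G (P G k D i) v ≤ᵇ k) ∧ inN G v w) (verts G) Pw
... | v , _ , e = P⇒source G k D i v (proj₁ (∧-true⁻ (P G k D i v) _ e))

kPDS-nonempty : ∀ G k D → 0 < n G → IsKPDS G k D → 1 ≤ card G D
kPDS-nonempty G k D 0<n dominates with P⇒source G k D (proj₁ (dominates 0 0<n)) 0 (proj₂ (dominates 0 0<n))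
... | v , v∈V , Dv = subst (1 ≤_) (sym (length-filter≡countᵇ D (verts G))) (countᵇ-pos (verts G) v∈V Dv)

card-singleton : ∀ G a → a < n G → card G (singleton a) ≡ 1
card-singleton G a a∈V rewrite length-filter≡countᵇ (singleton a) (verts G) = ≤-antisym
  (≤-trans (countᵇ-mono (verts G) (λ w → ≤-reflexive (cong bit (sym (∧-identityʳ (a ≡ᵇ w))))))
           (countᵇ-≡ᵇ≤ a true (verts G) (upTo⁺ (n G))))
  (countᵇ-pos (verts G) (∈-upTo⁺ a∈V) (≡⇒≡ᵇ-true {a} refl))

γ≡1 : ∀ G k a → a < n G → IsKPDS G k (singleton a) → γPk≡ G k 1
γ≡1 G k a a∈V dominates =
  (singleton a , card-singleton G a a∈V , dominates) , λ D → kPDS-nonempty G k D (≤-trans (s≤s z≤n) a∈V)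

lemma1 : (g k : ℕ) → 1 ≤ g → 2 ^ (g ∸ 1) ∸ 1 ≤ k →
    (a : ℕ) → a < 3 →
    IsKPDS (𝒢 g) k (singleton a) × γPk≡ (𝒢 g) k 1
lemma1 (suc m) k _ 2^m∸1≤k a a<3 = dominates , γ≡1 (𝒢 (suc m)) k a (<-≤-trans a<3 hubs∈V) dominates
  where
    open HubStructure (𝒢-structure m) using (hubs∈V)
    2^m≤1+k : 2 ^ m ≤ suc k
    2^m≤1+k = subst (_≤ suc k) (m+[n∸m]≡n (m^n>0 2 m)) (s≤s 2^m∸1≤k)
    dominates : IsKPDS (𝒢 (suc m)) k (singleton a)
    dominates = Observation.single-hub-dominates (𝒢-structure m) k 2^m≤1+k a a<3
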